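{- Let $m\ge1$, $n\ge0$. The lattice $\bigl(\mathfrak{A\!C}_{m,n}^{\bullet},\preceq\bigr)$ of proper mergings of an $m$-antichain and an $n$-chain is a quotient lattice of the lattice $\bigl(\mathfrak{S\!C}_{m,n}^{\bullet},\preceq\bigr)$ of proper mergings of an $m$-star and an $n$-chain; i.e., there is a surjective lattice homomorphism from the latter onto the former.
   Context: Let $(P,\le_P)$ and $(Q,\le_Q)$ be posets on disjoint ground sets. For $R\subseteq P\times Q$, $T\subseteq Q\times P$, define $\le_{R,T}$ on $P\cup Q$ by: $x\le_{R,T}y$ iff $x\le_P y$, or $x\le_Q y$, or $(x,y)\in R$, or $(x,y)\in T$. $(R,T)$ is a merging if $\le_{R,T}$ is reflexive and transitive, and a proper merging if moreover $R\cap T^{ -1}=\emptyset$. The set of proper mergings is partially ordered by $(R_1,T_1)\preceq(R_2,T_2)$ iff $R_1\subseteq R_2$ and $T_1\supseteq T_2$; this poset is a lattice with join $(R_1\cup R_2,T_1\cap T_2)$ and meet $(R_1\cap R_2,T_1\cup T_2)$. An $m$-antichain is the poset on $A=\{a_1,\dots,a_m\}$ with $a_i\le a_j$ iff $i=j$; an $m$-star is the poset on $S=\{s_0,s_1,\dots,s_m\}$ with $s\le s'$ iff $s=s'$ or $s=s_0$; an $n$-chain is the poset on $C=\{c_1,\dots,c_n\}$ with $c_i\le c_j$ iff $i\le j$. $\mathfrak{A\!C}_{m,n}^{\bullet}$ and $\mathfrak{S\!C}_{m,n}^{\bullet}$ denote the sets of proper mergings of an $m$-antichain and an $n$-chain,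 respectively of an $m$-star and an $n$-chain. -}

module Defs where

open import Data.Nat using (ℕ; zero; suc; _≤ᵇ_)
open import Data.Fin using (Fin; toℕ) renaming (zero to fzero)
open import Data.Fin.Properties using (_≟_)
open import Data.Bool using (Bool; true; false; _∧_; _∨_)
open import Data.Sum using (_⊎_; inj₁; inj₂)
open import Data.Product using (Σ; _×_; _,_; proj₁; proj₂; ∃)
open import Data.Empty using (⊥)
open import Relation.Nullary.Decidable using (⌊_⌋)
open import Relation.Binary.PropositionalEquality using (_≡_)

BRel : ℕ → ℕ → Set
BRel a b = Fin a → Fin b → Bool

antichain : (m : ℕ) → BRel m m
antichain m i j = ⌊ i ≟ j ⌋

-- m-star on {s_0,...,s_m} = Fin (suc m), s_0 = fzero : s ≤ s' iff s = s' or s = s_0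
star : (m : ℕ) → BRel (suc m) (suc m)
star m i j = ⌊ i ≟ j ⌋ ∨ ⌊ i ≟ fzero ⌋

chain : (n : ℕ) → BRel n n
chain n i j = toℕ i ≤ᵇ toℕ j

Pair : ℕ → ℕ → Set
Pair p q = BRel p q × BRel q p

mergedRel : {p q : ℕ} → BRel p p → BRel q q → Pair p q →
            Fin p ⊎ Fin q → Fin p ⊎ Fin q → Bool
mergedRel leP leQ (R , T) (inj₁ x) (inj₁ y) = leP x y
mergedRel leP leQ (R , T) (inj₂ x) (inj₂ y) = leQ x y
mergedRel leP leQ (R , T) (inj₁ x) (inj₂ y) = R x y
mergedRel leP leQ (R , T) (inj₂ x) (inj₁ y) = T x y

IsMerging : {p q : ℕ} → BRel p p → BRel q q → Pair p q → Set
IsMerging leP leQ RT =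
  (∀ x → mergedRel leP leQ RT x x ≡ true) ×
  (∀ x y z → mergedRel leP leQ RT x y ≡ true → mergedRel leP leQ RT y z ≡ true →
             mergedRel leP leQ RT x z ≡ true)

IsProperMerging : {p q : ℕ} → BRel p p → BRel q q → Pair p q → Set
IsProperMerging leP leQ (R , T) =
  IsMerging leP leQ (R , T) × (∀ x y → R x y ≡ true → T y x ≡ true → ⊥)

ProperMerging : {p q : ℕ} → BRel p p → BRel q q → Set
ProperMerging leP leQ = Σ (Pair _ _) (IsProperMerging leP leQ)

AC : ℕ → ℕ → Set
AC m n = ProperMerging (antichain m) (chain n)

SC : ℕ → ℕ → Set
SC m n = ProperMerging (star m) (chain n)

_≈ᴾ_ : {p q : ℕ} → Pair p q → Pair p q → Set
(R₁ , T₁) ≈ᴾ (R₂ , T₂) = (∀ x y → R₁ x y ≡ R₂ x y) × (∀ y x → T₁ y x ≡ T₂ y x)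

_≈_ : {p q : ℕ} {leP : BRel p p} {leQ : BRel q q} →
      ProperMerging leP leQ → ProperMerging leP leQ → Set
a ≈ b = proj₁ a ≈ᴾ proj₁ b

joinᴾ : {p q : ℕ} → Pair p q → Pair p q → Pair p q
joinᴾ (R₁ , T₁) (R₂ , T₂) = (λ x y → R₁ x y ∨ R₂ x y) , (λ y x → T₁ y x ∧ T₂ y x)

meetᴾ : {p q : ℕ} → Pair p q → Pair p q → Pair p q
meetᴾ (R₁ , T₁) (R₂ , T₂) = (λ x y → R₁ x y ∧ R₂ x y) , (λ y x → T₁ y x ∨ T₂ y x)

IsSurjectiveLatticeHom :
  {p q p' q' : ℕ} {leP : BRel p p} {leQ : BRel q q} {leP' : BRel p' p'} {leQ' : BRel q' q'} →
  (ProperMerging leP leQ → ProperMerging leP' leQ') → Set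
IsSurjectiveLatticeHom {leP = leP} {leQ} {leP'} {leQ'} f =
  (∀ a b → a ≈ b → f a ≈ f b) ×
  (∀ a b c → proj₁ c ≈ᴾ joinᴾ (proj₁ a) (proj₁ b) →
     proj₁ (f c) ≈ᴾ joinᴾ (proj₁ (f a)) (proj₁ (f b))) ×
  (∀ a b c → proj₁ c ≈ᴾ meetᴾ (proj₁ a) (proj₁ b) →
     proj₁ (f c) ≈ᴾ meetᴾ (proj₁ (f a)) (proj₁ (f b))) ×
  (∀ (b : ProperMerging leP' leQ') → ∃ λ a → f a ≈ b)

module Submission where

-- The m-antichain is the m-star with its centre s₀ removed, so
-- the embedding  e : A ⊎ C → S ⊎ C  (a_i ↦ s_i, c ↦ c) is an order embedding
-- for every pair (R , T), once R and T are restricted along it.  Hence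
--   * restricting a proper merging of S and C along e gives a proper merging
--     of A and C (pulling a preorder back along a relation-preserving map);
--     restriction is computed pointwise, so it respects equality, joins and
--     meets, i.e. it is a lattice homomorphism  𝔖ℭ• → 𝔄ℭ•;
--   * conversely, every proper merging of A and C extends to one of S and C
--     by putting s₀ below every chain element (R s₀ c = true, T c s₀ = false):
--     this adjoins a least element to a preorder, which again is a preorder.
--     Restricting the extension gives back the original merging, so the
--     homomorphism is onto.

open import Defs
open import Data.Nat using (ℕ; _≤_) renaming (suc to nsuc)
open import Data.Product using (Σ; _×_; _,_; proj₁; proj₂)
open import Data.Fin using (Fin; suc) renaming (zero to fzero)
open import Data.Sum using (_⊎_; inj₁; inj₂)
open import Data.Bool using (Bool; true; false)
open import Data.Bool.Properties using (∨-zeroʳ)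
open import Data.Fin.Properties using (_≟_)
open import Relation.Nullary using (yes; no)
open import Data.Empty using (⊥; ⊥-elim)
open import Relation.Binary.PropositionalEquality using (_≡_; refl; sym; trans)

IsPreorderᵇ : {X : Set} → (X → X → Bool) → Set
IsPreorderᵇ M =
  (∀ x → M x x ≡ true) ×
  (∀ x y z → M x y ≡ true → M y z ≡ true → M x z ≡ true)

pullback-preorder : {X Y : Set} (φ : X → Y) (M : Y → Y → Bool) (N : X → X → Bool) →
  (∀ x y → N x y ≡ M (φ x) (φ y)) → IsPreorderᵇ M → IsPreorderᵇ N
pullback-preorder φ M N agree (refl-M , trans-M) = refl-N , trans-N
  where
  refl-N : ∀ x → N x x ≡ true
  refl-N x = trans (agree x x) (refl-M (φ x))
  trans-N : ∀ x y z → N x y ≡ true → N y z ≡ true → N x z ≡ true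
  trans-N x y z p q = trans (agree x z)
    (trans-M (φ x) (φ y) (φ z) (trans (sym (agree x y)) p) (trans (sym (agree y z)) q))

data Cover {X Y : Set} (φ : X → Y) (b : Y) : Y → Set where
  bottom : Cover φ b b
  image  : ∀ x → Cover φ b (φ x)

adjoin-least : {X Y : Set} (φ : X → Y) (b : Y) (cover : ∀ y → Cover φ b y)
  (M : Y → Y → Bool) (N : X → X → Bool) →
  (∀ x y → N x y ≡ M (φ x) (φ y)) →
  (∀ y → M b y ≡ true) →
  (∀ x → M (φ x) b ≡ true → ⊥) →
  IsPreorderᵇ N → IsPreorderᵇ M
adjoin-least φ b cover M N agree least strict (refl-N , trans-N) = refl-M , trans-M
  where
  refl-M : ∀ y → M y y ≡ true
  refl-M y with cover y
  ... | bottom  = least b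
  ... | image x = trans (sym (agree x x)) (refl-N x)
  trans-M : ∀ x y z → M x y ≡ true → M y z ≡ true → M x z ≡ true
  trans-M x y z p q with cover x | cover y | cover z
  ... | bottom   | _        | _        = least z
  ... | image x' | bottom   | _        = ⊥-elim (strict x' p)
  ... | image x' | image y' | bottom   = ⊥-elim (strict y' q)
  ... | image x' | image y' | image z' = trans (sym (agree x' z'))
        (trans-N x' y' z' (trans (agree x' y') p) (trans (agree y' z') q))

module _ {m n : ℕ} where

  embed : Fin m ⊎ Fin n → Fin (nsuc m) ⊎ Fin n
  embed (inj₁ i) = inj₁ (suc i)
  embed (inj₂ c) = inj₂ c

  star-on-leaves : ∀ i j → antichain m i j ≡ star m (suc i) (suc j)
  star-on-leaves i j with i ≟ j
  ... | yes _ = refl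
  ... | no _  = refl

  restrict : Pair (nsuc m) n → Pair m n
  restrict (R , T) = (λ i c → R (suc i) c) , (λ c i → T c (suc i))

  restrict-merged : (RT : Pair (nsuc m) n) → ∀ x y →
    mergedRel (antichain m) (chain n) (restrict RT) x y
      ≡ mergedRel (star m) (chain n) RT (embed x) (embed y)
  restrict-merged RT (inj₁ i) (inj₁ j) = star-on-leaves i j
  restrict-merged RT (inj₁ i) (inj₂ c) = refl
  restrict-merged RT (inj₂ c) (inj₁ j) = refl
  restrict-merged RT (inj₂ c) (inj₂ d) = refl

  restrictᴹ : SC m n → AC m n
  restrictᴹ (RT , merging , proper) =
    restrict RT ,
    pullback-preorder embed (mergedRel (star m) (chain n) RT) _ (restrict-merged RT) merging ,
    (λ i c → proper (suc i) c)

  restrict-≈ᴾ : ∀ {RT RT′ : Pair (nsuc m) n} → RT ≈ᴾ RT′ → restrict RT ≈ᴾ restrict RT′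
  restrict-≈ᴾ (same-R , same-T) = (λ i c → same-R (suc i) c) , (λ c i → same-T c (suc i))

  extend : Pair m n → Pair (nsuc m) n
  extend (R , T) = R′ , T′
    where
    R′ : Fin (nsuc m) → Fin n → Bool
    R′ fzero   c = true
    R′ (suc i) c = R i c
    T′ : Fin n → Fin (nsuc m) → Bool
    T′ c fzero   = false
    T′ c (suc i) = T c i

  embed-cover : ∀ y → Cover embed (inj₁ fzero) y
  embed-cover (inj₁ fzero)   = bottom
  embed-cover (inj₁ (suc i)) = image (inj₁ i)
  embed-cover (inj₂ c)       = image (inj₂ c)

  centre-least : (RT : Pair m n) → ∀ y →
    mergedRel (star m) (chain n) (extend RT) (inj₁ fzero) y ≡ true
  centre-least RT (inj₁ i) = ∨-zeroʳ _
  centre-least RT (inj₂ c) = refl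

  centre-strict : (RT : Pair m n) → ∀ x →
    mergedRel (star m) (chain n) (extend RT) (embed x) (inj₁ fzero) ≡ true → ⊥
  centre-strict RT (inj₁ i) ()
  centre-strict RT (inj₂ c) ()

  extendᴹ : AC m n → SC m n
  extendᴹ (RT , merging , proper) =
    extend RT ,
    adjoin-least embed (inj₁ fzero) embed-cover _ _
      (restrict-merged (extend RT)) (centre-least RT) (centre-strict RT) merging ,
    proper-extension
    where
    proper-extension : ∀ x y → proj₁ (extend RT) x y ≡ true → proj₂ (extend RT) y x ≡ true → ⊥
    proper-extension fzero   c p ()
    proper-extension (suc i) c p q = proper i c p q

  restrict-extend : (a : AC m n) → restrictᴹ (extendᴹ a) ≈ a
  restrict-extend a = (λ i c → refl) , (λ c i → refl)

-- Restriction is a surjective lattice homomorphism; joins and meets are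
-- preserved because `restrict (joinᴾ a b)` and `joinᴾ (restrict a) (restrict b)`
-- (likewise for meets) coincide definitionally.  The argument does not need 1 ≤ m.
proposition3p1 : (m n : ℕ) → 1 ≤ m →
    Σ (SC m n → AC m n) IsSurjectiveLatticeHom
proposition3p1 m n _ =
  restrictᴹ ,
  (λ a b a≈b → restrict-≈ᴾ a≈b) ,
  (λ a b c c≈a∨b → restrict-≈ᴾ c≈a∨b) ,
  (λ a b c c≈a∧b → restrict-≈ᴾ c≈a∧b) ,
  (λ b → extendᴹ b , restrict-extend b)
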